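{- In the category of posets, contractions are stable under pullback along convex maps: if $f\colon P\to V$ is a contraction and $g\colon Q\to V$ is a convex map, then the projection $P\times_VQ\to Q$ is a contraction.
   Context: A map of posets $g\colon Q\to V$ is convex if for all $x,y\in Q$ and every $w\in V$ with $g(x)\le w\le g(y)$ there is a unique $p\in Q$ with $x\le p\le y$ and $g(p)=w$. Write $p\lessdot p'$ ($p'$ covers $p$) if $p<p'$ and there is no $x$ with $p<x<p'$. A map of posets $f\colon P\to V$ is a contraction if (1) $f$ is a monotone surjection; (2) for each $v\in V$ the fibre $P_v=f^{ -1}(v)$ is a connected convex subposet of $P$; (3) for any cover $v\lessdot v'$ in $V$ there is a cover $p\lessdot p'$ in $P$ with $f(p)=v$, $f(p')=v'$. The pullback $P\times_VQ$ is taken in the category of posets (pairs with the componentwise order). -}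

module Defs where

open import Level using (Level; _⊔_)
open import Data.Product using (Σ; ∃; _×_; _,_; proj₁; proj₂)
open import Data.Sum using (_⊎_)
open import Relation.Nullary using (¬_)
open import Relation.Binary.Bundles using (Poset)
open import Relation.Binary.Structures using (IsPartialOrder; IsPreorder; IsEquivalence)

-- Posets are stdlib 'Poset' bundles (order _≤_ up to a setoid equality _≈_).
-- "Equality" of elements always means _≈_ of the poset in question.

module _ {a ℓ₁ ℓ₂ b m₁ m₂ : Level} (P : Poset a ℓ₁ ℓ₂) (V : Poset b m₁ m₂) where
  private
    module P = Poset P
    module V = Poset V

  record IsMonotone (f : P.Carrier → V.Carrier) : Set (a ⊔ ℓ₁ ⊔ ℓ₂ ⊔ m₁ ⊔ m₂) where
    field
      cong : ∀ {x y} → x P.≈ y → f x V.≈ f y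
      mono : ∀ {x y} → x P.≤ y → f x V.≤ f y

  Surjective : (P.Carrier → V.Carrier) → Set (a ⊔ b ⊔ m₁)
  Surjective f = ∀ v → ∃ λ p → f p V.≈ v

  IsConvexMap : (P.Carrier → V.Carrier) → Set (a ⊔ ℓ₁ ⊔ ℓ₂ ⊔ b ⊔ m₁ ⊔ m₂)
  IsConvexMap g = ∀ x y w → g x V.≤ w → w V.≤ g y →
    Σ P.Carrier λ p → ((x P.≤ p × p P.≤ y) × g p V.≈ w) ×
      (∀ p' → (x P.≤ p' × p' P.≤ y) × g p' V.≈ w → p' P.≈ p)

module _ {a ℓ₁ ℓ₂ : Level} (P : Poset a ℓ₁ ℓ₂) where
  private
    module P = Poset P

  _<ₚ_ : P.Carrier → P.Carrier → Set (ℓ₁ ⊔ ℓ₂)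
  x <ₚ y = x P.≤ y × ¬ (x P.≈ y)

  _⋖_ : P.Carrier → P.Carrier → Set (a ⊔ ℓ₁ ⊔ ℓ₂)
  p ⋖ p' = (p <ₚ p') × ¬ (∃ λ x → p <ₚ x × x <ₚ p')

  IsConvexSubset : ∀ {s} → (P.Carrier → Set s) → Set (a ⊔ ℓ₂ ⊔ s)
  IsConvexSubset S = ∀ {x y z} → S x → S z → x P.≤ y → y P.≤ z → S y

  data Zigzag {s} (S : P.Carrier → Set s) : P.Carrier → P.Carrier → Set (a ⊔ ℓ₁ ⊔ ℓ₂ ⊔ s) where
    here : ∀ {x y} → x P.≈ y → Zigzag S x y
    step : ∀ {x x' y} → S x' → (x P.≤ x' ⊎ x' P.≤ x) → Zigzag S x' y → Zigzag S x y

  IsConnectedSubset : ∀ {s} → (P.Carrier → Set s) → Set (a ⊔ ℓ₁ ⊔ ℓ₂ ⊔ s)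
  IsConnectedSubset S = (∃ λ x → S x) × (∀ {x y} → S x → S y → Zigzag S x y)

module _ {a ℓ₁ ℓ₂ b m₁ m₂ : Level} (P : Poset a ℓ₁ ℓ₂) (V : Poset b m₁ m₂) where
  private
    module P = Poset P
    module V = Poset V

  Fibre : (P.Carrier → V.Carrier) → V.Carrier → P.Carrier → Set m₁
  Fibre f v p = f p V.≈ v

  record IsContraction (f : P.Carrier → V.Carrier) : Set (a ⊔ ℓ₁ ⊔ ℓ₂ ⊔ b ⊔ m₁ ⊔ m₂) where
    field
      monotone   : IsMonotone P V f
      surjective : Surjective P V f
      fibreConvex    : ∀ v → IsConvexSubset P (Fibre f v)
      fibreConnected : ∀ v → IsConnectedSubset P (Fibre f v)
      coverLift  : ∀ {v v'} → _⋖_ V v v' →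
        ∃ λ p → ∃ λ p' → _⋖_ P p p' × (f p V.≈ v × f p' V.≈ v')

module _ {a ℓ₁ ℓ₂ b m₁ m₂ c n₁ n₂ : Level}
         (P : Poset a ℓ₁ ℓ₂) (V : Poset b m₁ m₂) (Q : Poset c n₁ n₂)
         (f : Poset.Carrier P → Poset.Carrier V)
         (g : Poset.Carrier Q → Poset.Carrier V) where
  private
    module P = Poset P
    module V = Poset V
    module Q = Poset Q

  PBCarrier : Set (a ⊔ c ⊔ m₁)
  PBCarrier = Σ (P.Carrier × Q.Carrier) λ pq → f (proj₁ pq) V.≈ g (proj₂ pq)

  _≈PB_ : PBCarrier → PBCarrier → Set (ℓ₁ ⊔ n₁)
  ((p , q) , _) ≈PB ((p' , q') , _) = p P.≈ p' × q Q.≈ q'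

  _≤PB_ : PBCarrier → PBCarrier → Set (ℓ₂ ⊔ n₂)
  ((p , q) , _) ≤PB ((p' , q') , _) = p P.≤ p' × q Q.≤ q'

  Pullback : Poset (a ⊔ c ⊔ m₁) (ℓ₁ ⊔ n₁) (ℓ₂ ⊔ n₂)
  Pullback = record
    { Carrier = PBCarrier
    ; _≈_ = _≈PB_
    ; _≤_ = _≤PB_
    ; isPartialOrder = record
      { isPreorder = record
        { isEquivalence = record
          { refl = P.Eq.refl , Q.Eq.refl
          ; sym = λ (x , y) → P.Eq.sym x , Q.Eq.sym y
          ; trans = λ (x , y) (x' , y') → P.Eq.trans x x' , Q.Eq.trans y y'
          }
        ; reflexive = λ (x , y) → P.reflexive x , Q.reflexive y
        ; trans = λ (x , y) (x' , y') → P.trans x x' , Q.trans y y'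
        }
      ; antisym = λ (x , y) (x' , y') → P.antisym x x' , Q.antisym y y'
      }
    }

  pbProj₂ : PBCarrier → Q.Carrier
  pbProj₂ ((p , q) , _) = q

{-# OPTIONS --safe #-}
module Submission where

open import Level using (Level; _⊔_)
open import Relation.Binary.Bundles using (Poset)
open import Defs
open import Data.Product using (∃; _×_; _,_; proj₁; proj₂)
import Data.Sum as Sum
open import Relation.Nullary using (¬_)

-- The fibre of the projection over q is the fibre of f over g q, with q attached, so it is
-- connected and convex because the fibres of f are. A cover q ⋖ q' is sent by the convex
-- map g to a cover g q ⋖ g q' (a point strictly between would be hit by a point strictly
-- between q and q'), which lifts along f to p ⋖ p'; and (p , q) ⋖ (p' , q') in the pullback
-- because, by uniqueness in convexity, a point (x , y) between them with x ≈ p or x ≈ p'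
-- already has y ≈ q or y ≈ q'.

module _ {a ℓ₁ ℓ₂ b m₁ m₂ : Level} (P : Poset a ℓ₁ ℓ₂) (V : Poset b m₁ m₂) where
  private
    module P = Poset P
    module V = Poset V

  fibre-convex : ∀ {f} → IsMonotone P V f → ∀ v → IsConvexSubset P (Fibre P V f v)
  fibre-convex mf v fx≈v fz≈v x≤y y≤z =
    V.antisym (V.trans (mono y≤z) (V.reflexive fz≈v))
              (V.trans (V.reflexive (V.Eq.sym fx≈v)) (mono x≤y))
    where open IsMonotone mf

module ConvexMap {c n₁ n₂ b m₁ m₂ : Level} (Q : Poset c n₁ n₂) (V : Poset b m₁ m₂)
                 {g : Poset.Carrier Q → Poset.Carrier V}
                 (mg : IsMonotone Q V g) (conv : IsConvexMap Q V g) where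
  private
    module Q = Poset Q
    module V = Poset V
    open IsMonotone mg

  injective-on-interval : ∀ {q q' y y'} → q Q.≤ y → y Q.≤ q' → q Q.≤ y' → y' Q.≤ q' →
    g y V.≈ g y' → y Q.≈ y'
  injective-on-interval {q} {q'} {y} {y'} q≤y y≤q' q≤y' y'≤q' gy≈gy'
    with conv q q' (g y') (mono q≤y') (mono y'≤q')
  ... | _ , _ , unique =
    Q.Eq.trans (unique y ((q≤y , y≤q') , gy≈gy')) (Q.Eq.sym (unique y' ((q≤y' , y'≤q') , V.Eq.refl)))

  preserves-⋖ : ∀ {q q'} → _⋖_ Q q q' → _⋖_ V (g q) (g q')
  preserves-⋖ {q} {q'} ((q≤q' , q≉q') , noMiddle) =
    (mono q≤q' , gq≉gq') , noImageMiddle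
    where
    gq≉gq' : ¬ (g q V.≈ g q')
    gq≉gq' gq≈gq' = q≉q' (injective-on-interval Q.refl q≤q' q≤q' Q.refl gq≈gq')

    noImageMiddle : ¬ (∃ λ w → _<ₚ_ V (g q) w × _<ₚ_ V w (g q'))
    noImageMiddle (w , (gq≤w , gq≉w) , (w≤gq' , w≉gq')) with conv q q' w gq≤w w≤gq'
    ... | p , ((q≤p , p≤q') , gp≈w) , _ =
      noMiddle (p , (q≤p , λ q≈p → gq≉w (V.Eq.trans (cong q≈p) gp≈w))
                  , (p≤q' , λ p≈q' → w≉gq' (V.Eq.trans (V.Eq.sym gp≈w) (cong p≈q'))))

module PullbackProjection {a ℓ₁ ℓ₂ b m₁ m₂ c n₁ n₂ : Level}
         (P : Poset a ℓ₁ ℓ₂) (V : Poset b m₁ m₂) (Q : Poset c n₁ n₂)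
         (f : Poset.Carrier P → Poset.Carrier V)
         (g : Poset.Carrier Q → Poset.Carrier V) where
  private
    module P = Poset P
    module V = Poset V
    module Q = Poset Q

  R : Poset (a ⊔ c ⊔ m₁) (ℓ₁ ⊔ n₁) (ℓ₂ ⊔ n₂)
  R = Pullback P V Q f g

  π : PBCarrier P V Q f g → Q.Carrier
  π = pbProj₂ P V Q f g

  π₁ : PBCarrier P V Q f g → P.Carrier
  π₁ ((p , _) , _) = p

  π-monotone : IsMonotone R Q π
  π-monotone = record { cong = proj₂ ; mono = proj₂ }

  π-surjective : Surjective P V f → Surjective R Q π
  π-surjective surj q with surj (g q)
  ... | p , fp≈gq = ((p , q) , fp≈gq) , Q.Eq.refl

  zigzag-lift : ∀ {q r s} → π r Q.≈ q → π s Q.≈ q →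
    Zigzag P (Fibre P V f (g q)) (π₁ r) (π₁ s) → Zigzag R (Fibre R Q π q) r s
  zigzag-lift r≈q s≈q (here x≈y) = here (x≈y , Q.Eq.trans r≈q (Q.Eq.sym s≈q))
  zigzag-lift {q} r≈q s≈q (step {x' = x'} fx'≈gq comparable zigzag) =
    step {x' = (x' , q) , fx'≈gq} Q.Eq.refl
      (Sum.map (_, Q.reflexive r≈q) (_, Q.reflexive (Q.Eq.sym r≈q)) comparable)
      (zigzag-lift Q.Eq.refl s≈q zigzag)

  π-fibreConnected : IsMonotone Q V g → (∀ v → IsConnectedSubset P (Fibre P V f v)) →
    Surjective P V f → ∀ q → IsConnectedSubset R (Fibre R Q π q)
  π-fibreConnected mg connected surj q = π-surjective surj q , lift-zigzag
    where
    open IsMonotone mg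
    lift-zigzag : ∀ {r s} → π r Q.≈ q → π s Q.≈ q → Zigzag R (Fibre R Q π q) r s
    lift-zigzag {(_ , _) , fx≈gqx} {(_ , _) , fy≈gqy} r≈q s≈q =
      zigzag-lift r≈q s≈q (proj₂ (connected (g q))
        (V.Eq.trans fx≈gqx (cong r≈q)) (V.Eq.trans fy≈gqy (cong s≈q)))

  pair-⋖ : IsMonotone P V f → IsMonotone Q V g → IsConvexMap Q V g →
    ∀ {p p' q q'} (fp≈gq : f p V.≈ g q) (fp'≈gq' : f p' V.≈ g q') →
    _⋖_ P p p' → _<ₚ_ Q q q' → _⋖_ R ((p , q) , fp≈gq) ((p' , q') , fp'≈gq')
  pair-⋖ mf mg conv {p} {p'} {q} {q'} fp≈gq fp'≈gq' ((p≤p' , _) , noMiddle) (q≤q' , q≉q') =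
    ((p≤p' , q≤q') , λ pq≈pq' → q≉q' (proj₂ pq≈pq')) , noPairMiddle
    where
    open ConvexMap Q V mg conv
    open IsMonotone mf using (cong)

    noPairMiddle : ¬ (∃ λ r → _<ₚ_ R ((p , q) , fp≈gq) r × _<ₚ_ R r ((p' , q') , fp'≈gq'))
    noPairMiddle (((x , y) , fx≈gy) , ((p≤x , q≤y) , pq≉xy) , ((x≤p' , y≤q') , xy≉pq')) =
      noMiddle (x , (p≤x , p≉x) , (x≤p' , x≉p'))
      where
      p≉x : ¬ (p P.≈ x)
      p≉x p≈x = pq≉xy (p≈x , injective-on-interval Q.refl q≤q' q≤y y≤q'
        (V.Eq.trans (V.Eq.sym fp≈gq) (V.Eq.trans (cong p≈x) fx≈gy)))
      x≉p' : ¬ (x P.≈ p')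
      x≉p' x≈p' = xy≉pq' (x≈p' , injective-on-interval q≤y y≤q' q≤q' Q.refl
        (V.Eq.trans (V.Eq.sym fx≈gy) (V.Eq.trans (cong x≈p') fp'≈gq')))

  π-coverLift : IsContraction P V f → IsMonotone Q V g → IsConvexMap Q V g →
    ∀ {q q'} → _⋖_ Q q q' → ∃ λ r → ∃ λ r' → _⋖_ R r r' × (π r Q.≈ q × π r' Q.≈ q')
  π-coverLift cf mg conv q⋖q'
    with IsContraction.coverLift cf (ConvexMap.preserves-⋖ Q V mg conv q⋖q')
  ... | p , p' , p⋖p' , fp≈gq , fp'≈gq' =
    ((p , _) , fp≈gq) , ((p' , _) , fp'≈gq') , pair-⋖ (IsContraction.monotone cf) mg conv fp≈gq fp'≈gq' p⋖p' (proj₁ q⋖q')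
      , Q.Eq.refl , Q.Eq.refl

lemma2p6 : ∀ {a ℓ₁ ℓ₂ b m₁ m₂ c n₁ n₂ : Level}
    (P : Poset a ℓ₁ ℓ₂) (V : Poset b m₁ m₂) (Q : Poset c n₁ n₂)
    (f : Poset.Carrier P → Poset.Carrier V)
    (g : Poset.Carrier Q → Poset.Carrier V) →
    IsContraction P V f →
    IsMonotone Q V g →
    IsConvexMap Q V g →
    IsContraction (Pullback P V Q f g) Q (pbProj₂ P V Q f g)
lemma2p6 P V Q f g cf mg conv = record
  { monotone       = π-monotone
  ; surjective     = π-surjective surjective
  ; fibreConvex    = fibre-convex R Q π-monotone
  ; fibreConnected = π-fibreConnected mg fibreConnected surjective
  ; coverLift      = π-coverLift cf mg conv
  }
  where
  open PullbackProjection P V Q f g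
  open IsContraction cf
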